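{- For every $n \geq 1$, the word $\varphi^n(2)$ avoids $7/4^+$-powers, i.e., every (nonempty) factor of $\varphi^n(2)$ has exponent at most $7/4$.
   Context: Words are over the alphabet $\{1,2,3\}$. For a word $a$, $\sigma(a)$ is the word obtained from $a$ by exchanging every $1$ with $2$ (and every $2$ with $1$), and $\rho(a)$ is the word obtained from $a$ by exchanging every $2$ with $3$. Define $\varphi(a) = \sigma(a)\,a\,\rho(a)$ (concatenation), and $\varphi^n$ denotes the $n$-fold iterate; e.g. $\varphi(2)=123$, $\varphi^2(2)=213123132$. A word $x = x_1\cdots x_m$ has period $p$ if $x_i = x_{i+p}$ for all $1\le i\le m-p$; the exponent of $x$ is $m/p$ where $p$ is the least period of $x$. A factor is a contiguous subword. -}

module Defs where

open import Data.Nat using (ℕ; zero; suc; _+_; _*_; _≤_; _<_)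
open import Data.List using (List; []; _∷_; _++_; length; map; lookup)
open import Data.Fin using (Fin; fromℕ<)
open import Data.Product using (Σ; ∃; _×_; _,_)
open import Relation.Binary.PropositionalEquality using (_≡_)

data Letter : Set where
  l1 l2 l3 : Letter

Word : Set
Word = List Letter

σL : Letter → Letter
σL l1 = l2
σL l2 = l1
σL l3 = l3

ρL : Letter → Letter
ρL l1 = l1
ρL l2 = l3
ρL l3 = l2

σ : Word → Word
σ = map σL

ρ : Word → Word
ρ = map ρL

φ : Word → Word
φ a = σ a ++ a ++ ρ a

φ^ : ℕ → Word → Word
φ^ zero a = a
φ^ (suc n) a = φ (φ^ n a)

Factor : Word → Word → Set
Factor x w = Σ Word λ u → Σ Word λ v → u ++ x ++ v ≡ w

-- x = x_1 ... x_m has period p (1 ≤ p ≤ m): x_i = x_{i+p} for all 1 ≤ i ≤ m - p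
-- (0-indexed: for all i with i + p < m, x[i] = x[i+p])
HasPeriod : Word → ℕ → Set
HasPeriod x p =
  1 ≤ p × p ≤ length x ×
  ((i : ℕ) → (h : i + p < length x) →
     lookup x (fromℕ< (Data.Nat.Properties.≤-trans (Data.Nat.Properties.m≤m+n (suc i) p) h))
       ≡ lookup x (fromℕ< h))
  where import Data.Nat.Properties

IsLeastPeriod : Word → ℕ → Set
IsLeastPeriod x p = HasPeriod x p × ((q : ℕ) → HasPeriod x q → p ≤ q)

ExponentAtMost7/4 : Word → Set
ExponentAtMost7/4 x = (p : ℕ) → IsLeastPeriod x p → 4 * length x ≤ 7 * p

module Submission where

open import Defs
open import Data.Nat using (ℕ; _≤_; _<_)
open import Data.List using ([_]; length)

open import Data.Nat using (zero; suc; _+_; _*_; _∸_; _/_; _≤?_; z≤n; s≤s; s≤s⁻¹; z<s)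
import Data.Nat.Properties as ℕ
open import Data.Nat.DivMod using (_divMod_; result; +-distrib-/-∣ˡ; m*n/n≡m; m<n⇒m/n≡0)
open import Data.Nat.Divisibility using (m∣m*n)
open import Data.Nat.Tactic.RingSolver using (solve-∀)
open import Data.Fin as Fin using (Fin; toℕ; fromℕ<; inject≤; _↑ʳ_; _↑ˡ_; quotient; remainder)
open import Data.Fin.Patterns
import Data.Fin.Properties as Finₚ
open import Data.Vec as Vec using (Vec; []; _∷_; tabulate; replicate)
import Data.Vec.Properties as Vecₚ
open import Data.List using (List; []; _∷_; _++_; map; concatMap; allFin; lookup)
open import Data.List.Properties using (map-++; map-cong; map-∘)
open import Data.List.Relation.Unary.All as All using (All)
open import Data.List.Relation.Unary.All.Properties using (all⁺)
import Data.List.Relation.Unary.Any as ListAny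
open import Data.List.Relation.Unary.Any using (here; there)
open import Data.List.Relation.Unary.Any.Properties using (any⁺; any⁻)
open import Data.List.Membership.Propositional using (_∈_)
open import Data.List.Membership.Propositional.Properties using (∈-concatMap⁺; ∈-map⁺; ∈-allFin)
open import Data.Maybe as Maybe using (Maybe; just; nothing; zipWith)
import Data.Maybe.Properties as Maybeₚ
import Data.Maybe.Relation.Unary.Any as MaybeAny
open import Data.Bool using (T)
open import Data.Bool.Properties using (T?)
open import Data.Bool.ListAction using (all; any)
open import Data.Product using (∃; ∃₂; _×_; _,_)
open import Function using (_∘_)
open import Level using (0ℓ)
open import Relation.Binary.Definitions using (DecidableEquality)
open import Relation.Binary.PropositionalEquality
  using (_≡_; refl; sym; trans; cong; cong₂; subst; subst₂; module ≡-Reasoning)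
open import Relation.Nullary using (¬_; yes; no; contradiction)
open import Relation.Nullary.Decidable
  using (Dec; map′; from-yes; isYes; toWitness; fromWitness; ¬?; _×-dec_; _→-dec_)
open import Relation.Unary using (Pred; Decidable)

-- Identify a letter with the permutation π of {1,2,3} that sends 2 to it. Then σ and ρ become left
-- multiplication by the transpositions (12) and (23), and φ^n(2) is read off a word Φ n of
-- permutations which is equally obtained from Φ (n-1) by replacing each π by π(12), π, π(23). So
-- position 3i + d of Φ (n+1) holds Φ n [i] times the block permutation of the digit d, and the
-- quotient Δ = Φ[a]⁻¹ Φ[a + p] at level n+1 is β⁻¹ Δ′ β′ for block permutations β, β′ and a quotient
-- Δ′ at level n, at position ⌊a/3⌋ and period ⌊p/3⌋ or ⌊p/3⌋ + 1. Two positions at distance p carry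
-- the same letter iff their quotient fixes 2.
--
-- A run of L consecutive such coincidences satisfies 4 L ≤ 3 p, by induction on n. The quotients for
-- the periods q and q + 1 at four consecutive positions form a "window", and the windows at level
-- n+1 are computed from those at level n; the reachable windows are listed explicitly. When 3 ∤ p, a
-- decision procedure over them shows that the runs are short enough. When p = 3q, it shows instead
-- that three consecutive coincidences force the quotients at level n below them to be the identity,
-- so the run yields a run of length ⌈L/3⌉ with period q, and the induction hypothesis gives
-- 4 L ≤ 9 q. A factor of length m with period p yields a run of length m - p, whence 4 m ≤ 7 p.

module FromFinEncoding {A : Set} {n} (encode : A → Fin n) (decode : Fin n → A)
                       (decode-encode : ∀ a → decode (encode a) ≡ a) where

  infix 4 _≟_
  _≟_ : DecidableEquality A
  a ≟ b = map′ encode-injective (cong encode) (encode a Finₚ.≟ encode b)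
    where
    encode-injective : encode a ≡ encode b → a ≡ b
    encode-injective eq = trans (sym (decode-encode a)) (trans (cong decode eq) (decode-encode b))

  ∀? : {P : Pred A 0ℓ} → Decidable P → Dec (∀ a → P a)
  ∀? {P} P? = map′ (λ h a → subst P (decode-encode a) (h (encode a))) (λ h k → h (decode k))
                   (Finₚ.all? (P? ∘ decode))

-- The symmetric group on {1,2,3}

-- pabc is the permutation 1 ↦ a, 2 ↦ b, 3 ↦ c.
data Perm : Set where
  p123 p132 p213 p231 p312 p321 : Perm

app : Perm → Letter → Letter
app p123 l1 = l1
app p123 l2 = l2
app p123 l3 = l3
app p132 l1 = l1
app p132 l2 = l3
app p132 l3 = l2
app p213 l1 = l2
app p213 l2 = l1
app p213 l3 = l3
app p231 l1 = l2
app p231 l2 = l3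
app p231 l3 = l1
app p312 l1 = l3
app p312 l2 = l1
app p312 l3 = l2
app p321 l1 = l3
app p321 l2 = l2
app p321 l3 = l1

-- Composition: app (a · b) = app a ∘ app b.
infixl 7 _·_
_·_ : Perm → Perm → Perm
p123 · π    = π
p132 · p123 = p132
p132 · p132 = p123
p132 · p213 = p312
p132 · p231 = p321
p132 · p312 = p213
p132 · p321 = p231
p213 · p123 = p213
p213 · p132 = p231
p213 · p213 = p123
p213 · p231 = p132
p213 · p312 = p321
p213 · p321 = p312
p231 · p123 = p231
p231 · p132 = p213
p231 · p213 = p321
p231 · p231 = p312
p231 · p312 = p123
p231 · p321 = p132
p312 · p123 = p312
p312 · p132 = p321
p312 · p213 = p132
p312 · p231 = p123
p312 · p312 = p231
p312 · p321 = p213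
p321 · p123 = p321
p321 · p132 = p312
p321 · p213 = p231
p321 · p231 = p213
p321 · p312 = p132
p321 · p321 = p123

infix 8 _⁻¹
_⁻¹ : Perm → Perm
p231 ⁻¹ = p312
p312 ⁻¹ = p231
π    ⁻¹ = π

σₚ ρₚ : Perm
σₚ = p213
ρₚ = p132

encodePerm : Perm → Fin 6
encodePerm p123 = 0F
encodePerm p132 = 1F
encodePerm p213 = 2F
encodePerm p231 = 3F
encodePerm p312 = 4F
encodePerm p321 = 5F

decodePerm : Fin 6 → Perm
decodePerm 0F = p123
decodePerm 1F = p132
decodePerm 2F = p213
decodePerm 3F = p231
decodePerm 4F = p312
decodePerm 5F = p321

decode-encodePerm : ∀ π → decodePerm (encodePerm π) ≡ π
decode-encodePerm p123 = refl
decode-encodePerm p132 = refl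
decode-encodePerm p213 = refl
decode-encodePerm p231 = refl
decode-encodePerm p312 = refl
decode-encodePerm p321 = refl

encodeLetter : Letter → Fin 3
encodeLetter l1 = 0F
encodeLetter l2 = 1F
encodeLetter l3 = 2F

decodeLetter : Fin 3 → Letter
decodeLetter 0F = l1
decodeLetter 1F = l2
decodeLetter 2F = l3

decode-encodeLetter : ∀ l → decodeLetter (encodeLetter l) ≡ l
decode-encodeLetter l1 = refl
decode-encodeLetter l2 = refl
decode-encodeLetter l3 = refl

module Perms   = FromFinEncoding encodePerm decodePerm decode-encodePerm
module Letters = FromFinEncoding encodeLetter decodeLetter decode-encodeLetter

·-assoc : ∀ a b c → a · (b · c) ≡ a · b · c
·-assoc = from-yes (Perms.∀? λ a → Perms.∀? λ b → Perms.∀? λ c → a · (b · c) Perms.≟ a · b · c)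

⁻¹-anti-· : ∀ a b → (a · b) ⁻¹ ≡ b ⁻¹ · a ⁻¹
⁻¹-anti-· = from-yes (Perms.∀? λ a → Perms.∀? λ b → (a · b) ⁻¹ Perms.≟ b ⁻¹ · a ⁻¹)

app-· : ∀ a b l → app (a · b) l ≡ app a (app b l)
app-· = from-yes (Perms.∀? λ a → Perms.∀? λ b → Letters.∀? λ l → app (a · b) l Letters.≟ app a (app b l))

app-⁻¹ : ∀ a l → app (a ⁻¹) (app a l) ≡ l
app-⁻¹ = from-yes (Perms.∀? λ a → Letters.∀? λ l → app (a ⁻¹) (app a l) Letters.≟ l)

σL≗σₚ : ∀ l → σL l ≡ app σₚ l
σL≗σₚ = from-yes (Letters.∀? λ l → σL l Letters.≟ app σₚ l)

ρL≗ρₚ : ∀ l → ρL l ≡ app ρₚ l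
ρL≗ρₚ = from-yes (Letters.∀? λ l → ρL l Letters.≟ app ρₚ l)

infixl 7 _⟶_
_⟶_ : Perm → Perm → Perm
a ⟶ b = a ⁻¹ · b

⟶-· : ∀ a b g h → (a · g) ⟶ (b · h) ≡ g ⁻¹ · (a ⟶ b · h)
⟶-· a b g h = begin
  (a · g) ⁻¹ · (b · h)      ≡⟨ cong (_· (b · h)) (⁻¹-anti-· a g) ⟩
  g ⁻¹ · a ⁻¹ · (b · h)     ≡⟨ ·-assoc (g ⁻¹) (a ⁻¹) (b · h) ⟨
  g ⁻¹ · (a ⁻¹ · (b · h))   ≡⟨ cong (g ⁻¹ ·_) (·-assoc (a ⁻¹) b h) ⟩
  g ⁻¹ · (a ⁻¹ · b · h)     ∎
  where open ≡-Reasoning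

letter : Perm → Letter
letter π = app π l2

letter-⟶ : ∀ a b → letter a ≡ letter b → letter (a ⟶ b) ≡ l2
letter-⟶ a b eq = begin
  app (a ⁻¹ · b) l2        ≡⟨ app-· (a ⁻¹) b l2 ⟩
  app (a ⁻¹) (letter b)    ≡⟨ cong (app (a ⁻¹)) eq ⟨
  app (a ⁻¹) (app a l2)    ≡⟨ app-⁻¹ a l2 ⟩
  l2                       ∎
  where open ≡-Reasoning

Digit : Set
Digit = Fin 3

-- The digit d of a position in φ(a) = σ(a) a ρ(a) selects the block σ(a), a or ρ(a).
block : Digit → Perm
block 0F = σₚ
block 1F = p123
block 2F = ρₚ

conj : Digit → Digit → Perm → Perm
conj d e π = block d ⁻¹ · (π · block e)

carry : Digit → Digit → Fin 2
carry 1F 2F = 1F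
carry 2F 1F = 1F
carry 2F 2F = 1F
carry _  _  = 0F

infixl 6 _⊕_
_⊕_ : Digit → Digit → Digit
0F ⊕ r  = r
d  ⊕ 0F = d
1F ⊕ 1F = 2F
1F ⊕ 2F = 0F
2F ⊕ 1F = 0F
2F ⊕ 2F = 1F

digit-sum : ∀ d r → toℕ d + toℕ r ≡ 3 * toℕ (carry d r) + toℕ (d ⊕ r)
digit-sum = from-yes (Finₚ.all? λ d → Finₚ.all? λ r → toℕ d + toℕ r ℕ.≟ 3 * toℕ (carry d r) + toℕ (d ⊕ r))

carry-0F : ∀ e → carry e 0F ≡ 0F
carry-0F 0F = refl
carry-0F 1F = refl
carry-0F 2F = refl

data Base3 : ℕ → Set where
  _·3+_ : ∀ q (d : Digit) → Base3 (3 * q + toℕ d)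

base3 : ∀ m → Base3 m
base3 m with m divMod 3
... | result q d refl = subst Base3 (trans (ℕ.+-comm (3 * q) (toℕ d)) (cong (toℕ d +_) (ℕ.*-comm 3 q))) (q ·3+ d)

[3q+d]/3≡q : ∀ q (d : Digit) → (3 * q + toℕ d) / 3 ≡ q
[3q+d]/3≡q q d = begin
  (3 * q + toℕ d) / 3      ≡⟨ +-distrib-/-∣ˡ (toℕ d) (m∣m*n q) ⟩
  3 * q / 3 + toℕ d / 3    ≡⟨ cong₂ _+_ (trans (cong (_/ 3) (ℕ.*-comm 3 q)) (m*n/n≡m q 3)) (m<n⇒m/n≡0 (Finₚ.toℕ<n d)) ⟩
  q + 0                    ≡⟨ ℕ.+-identityʳ q ⟩
  q                        ∎
  where open ≡-Reasoning

infixl 5 _!?_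
_!?_ : {A : Set} → List A → ℕ → Maybe A
[]       !? _     = nothing
(x ∷ xs) !? zero  = just x
(x ∷ xs) !? suc j = xs !? j

!?-++ʳ : ∀ {A : Set} (u w : List A) t → (u ++ w) !? (length u + t) ≡ w !? t
!?-++ʳ []      w t = refl
!?-++ʳ (_ ∷ u) w t = !?-++ʳ u w t

!?-++ˡ : ∀ {A : Set} (x v : List A) {t} → t < length x → (x ++ v) !? t ≡ x !? t
!?-++ˡ (_ ∷ x) v {zero}  _   = refl
!?-++ˡ (_ ∷ x) v {suc t} t<n = !?-++ˡ x v (s≤s⁻¹ t<n)

!?-lookup : ∀ {A : Set} (xs : List A) {t} (t<n : t < length xs) → xs !? t ≡ just (lookup xs (fromℕ< t<n))
!?-lookup (_ ∷ xs) {zero}  _   = refl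
!?-lookup (_ ∷ xs) {suc t} t<n = !?-lookup xs (s≤s⁻¹ t<n)

map-!? : ∀ {A B : Set} (f : A → B) xs j → map f xs !? j ≡ Maybe.map f (xs !? j)
map-!? f []       j       = refl
map-!? f (x ∷ xs) zero    = refl
map-!? f (x ∷ xs) (suc j) = map-!? f xs j

-- The permutation words Φ n and their quotients

Φ : ℕ → List Perm
Φ zero    = [ p123 ]
Φ (suc n) = map (σₚ ·_) (Φ n) ++ Φ n ++ map (ρₚ ·_) (Φ n)

map-letter-· : ∀ (f : Letter → Letter) c → (∀ l → f l ≡ app c l) →
               ∀ πs → map f (map letter πs) ≡ map letter (map (c ·_) πs)
map-letter-· f c f≗c πs = begin
  map f (map letter πs)        ≡⟨ map-∘ πs ⟨
  map (f ∘ letter) πs          ≡⟨ map-cong (λ π → trans (f≗c (letter π)) (sym (app-· c π l2))) πs ⟩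
  map (letter ∘ (c ·_)) πs     ≡⟨ map-∘ πs ⟩
  map letter (map (c ·_) πs)   ∎
  where open ≡-Reasoning

φ^≡letters : ∀ n → φ^ n [ l2 ] ≡ map letter (Φ n)
φ^≡letters zero    = refl
φ^≡letters (suc n) = begin
  φ (φ^ n [ l2 ])
    ≡⟨ cong φ (φ^≡letters n) ⟩
  σ (map letter πs) ++ map letter πs ++ ρ (map letter πs)
    ≡⟨ cong₂ (λ u w → u ++ map letter πs ++ w) (map-letter-· σL σₚ σL≗σₚ πs) (map-letter-· ρL ρₚ ρL≗ρₚ πs) ⟩
  map letter (map (σₚ ·_) πs) ++ map letter πs ++ map letter (map (ρₚ ·_) πs)
    ≡⟨ cong (map letter (map (σₚ ·_) πs) ++_) (map-++ letter πs _) ⟨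
  map letter (map (σₚ ·_) πs) ++ map letter (πs ++ map (ρₚ ·_) πs)
    ≡⟨ map-++ letter (map (σₚ ·_) πs) _ ⟨
  map letter (Φ (suc n))
    ∎
  where
  πs = Φ n
  open ≡-Reasoning

refine : List Perm → List Perm
refine []       = []
refine (π ∷ πs) = π · block 0F ∷ π · block 1F ∷ π · block 2F ∷ refine πs

refine-++ : ∀ πs τs → refine (πs ++ τs) ≡ refine πs ++ refine τs
refine-++ []       τs = refl
refine-++ (π ∷ πs) τs = cong (λ ρs → _ ∷ _ ∷ _ ∷ ρs) (refine-++ πs τs)

map-refine : ∀ c πs → map (c ·_) (refine πs) ≡ refine (map (c ·_) πs)
map-refine c []       = refl
map-refine c (π ∷ πs) rewrite ·-assoc c π (block 0F) | ·-assoc c π (block 1F) | ·-assoc c π (block 2F) =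
  cong (λ ρs → _ ∷ _ ∷ _ ∷ ρs) (map-refine c πs)

Φ-refine : ∀ n → Φ (suc n) ≡ refine (Φ n)
Φ-refine zero    = refl
Φ-refine (suc n) = begin
  map (σₚ ·_) (Φ (suc n)) ++ Φ (suc n) ++ map (ρₚ ·_) (Φ (suc n))
    ≡⟨ cong (λ πs → map (σₚ ·_) πs ++ πs ++ map (ρₚ ·_) πs) (Φ-refine n) ⟩
  map (σₚ ·_) (refine πs) ++ refine πs ++ map (ρₚ ·_) (refine πs)
    ≡⟨ cong₂ (λ u w → u ++ refine πs ++ w) (map-refine σₚ πs) (map-refine ρₚ πs) ⟩
  refine (map (σₚ ·_) πs) ++ refine πs ++ refine (map (ρₚ ·_) πs)
    ≡⟨ cong (refine (map (σₚ ·_) πs) ++_) (refine-++ πs _) ⟨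
  refine (map (σₚ ·_) πs) ++ refine (πs ++ map (ρₚ ·_) πs)
    ≡⟨ refine-++ (map (σₚ ·_) πs) _ ⟨
  refine (Φ (suc n))
    ∎
  where
  πs = Φ n
  open ≡-Reasoning

refine-!? : ∀ πs i d → refine πs !? (3 * i + toℕ d) ≡ Maybe.map (_· block d) (πs !? i)
refine-!? []       i       d  = refl
refine-!? (π ∷ πs) zero    0F = refl
refine-!? (π ∷ πs) zero    1F = refl
refine-!? (π ∷ πs) zero    2F = refl
refine-!? (π ∷ πs) (suc i) d  = trans (cong (λ j → refine (π ∷ πs) !? (j + toℕ d)) (ℕ.*-suc 3 i)) (refine-!? πs i d)

Φ-!? : ∀ n i d → Φ (suc n) !? (3 * i + toℕ d) ≡ Maybe.map (_· block d) (Φ n !? i)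
Φ-!? n i d rewrite Φ-refine n = refine-!? (Φ n) i d

-- nothing as soon as j + p lies beyond the end of Φ n.
Δ : ℕ → ℕ → ℕ → Maybe Perm
Δ n p j = zipWith _⟶_ (Φ n !? j) (Φ n !? (j + p))

Δ-zero : ∀ p j → Δ 0 (suc p) j ≡ nothing
Δ-zero p j rewrite ℕ.+-suc j p with Φ 0 !? j
... | just _  = refl
... | nothing = refl

zipWith-⟶-map : ∀ x y g h →
                zipWith _⟶_ (Maybe.map (_· g) x) (Maybe.map (_· h) y) ≡ Maybe.map (λ π → g ⁻¹ · (π · h)) (zipWith _⟶_ x y)
zipWith-⟶-map (just a) (just b) g h = cong just (⟶-· a b g h)
zipWith-⟶-map (just a) nothing  g h = refl
zipWith-⟶-map nothing  y        g h = refl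

position-sum : ∀ j q d r → 3 * j + toℕ d + (3 * q + toℕ r) ≡ 3 * (j + (toℕ (carry d r) + q)) + toℕ (d ⊕ r)
position-sum j q d r = begin
  3 * j + toℕ d + (3 * q + toℕ r)                       ≡⟨ regroup j q (toℕ d) (toℕ r) ⟩
  3 * j + 3 * q + (toℕ d + toℕ r)                       ≡⟨ cong (3 * j + 3 * q +_) (digit-sum d r) ⟩
  3 * j + 3 * q + (3 * toℕ (carry d r) + toℕ (d ⊕ r))   ≡⟨ factor j q (toℕ (carry d r)) (toℕ (d ⊕ r)) ⟩
  3 * (j + (toℕ (carry d r) + q)) + toℕ (d ⊕ r)         ∎
  where
  open ≡-Reasoning
  regroup : ∀ j q x y → 3 * j + x + (3 * q + y) ≡ 3 * j + 3 * q + (x + y)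
  regroup = solve-∀
  factor : ∀ j q c e → 3 * j + 3 * q + (3 * c + e) ≡ 3 * (j + (c + q)) + e
  factor = solve-∀

Δ-descent : ∀ n q r j d →
            Δ (suc n) (3 * q + toℕ r) (3 * j + toℕ d) ≡ Maybe.map (conj d (d ⊕ r)) (Δ n (toℕ (carry d r) + q) j)
Δ-descent n q r j d = begin
  zipWith _⟶_ (Φ (suc n) !? (3 * j + toℕ d)) (Φ (suc n) !? (3 * j + toℕ d + (3 * q + toℕ r)))
    ≡⟨ cong₂ (zipWith _⟶_) (Φ-!? n j d) (trans (cong (Φ (suc n) !?_) (position-sum j q d r)) (Φ-!? n _ (d ⊕ r))) ⟩
  zipWith _⟶_ (Maybe.map (_· block d) (Φ n !? j)) (Maybe.map (_· block (d ⊕ r)) (Φ n !? (j + (toℕ (carry d r) + q))))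
    ≡⟨ zipWith-⟶-map (Φ n !? j) _ (block d) (block (d ⊕ r)) ⟩
  Maybe.map (conj d (d ⊕ r)) (Δ n (toℕ (carry d r) + q) j)
    ∎
  where open ≡-Reasoning

Fixes2 : Maybe Perm → Set
Fixes2 = MaybeAny.Any (λ π → letter π ≡ l2)

fixes2? : Decidable Fixes2
fixes2? = MaybeAny.dec (λ π → letter π Letters.≟ l2)

fixes2-of-identity : ∀ {m} → m ≡ just p123 → Fixes2 m
fixes2-of-identity refl = MaybeAny.just refl

fixes2-of-equal-letters : ∀ {m m′ ℓ} → Maybe.map letter m ≡ just ℓ → Maybe.map letter m′ ≡ just ℓ →
                          Fixes2 (zipWith _⟶_ m m′)
fixes2-of-equal-letters {just a} {just b} refl eq = MaybeAny.just (letter-⟶ a b (sym (Maybeₚ.just-injective eq)))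

-- The positions a, …, a + L - 1 of φ^n(2) carry the same letters as the positions p further on.
PeriodicRun : ℕ → ℕ → ℕ → ℕ → Set
PeriodicRun n p a L = ∀ t → t < L → Fixes2 (Δ n p (a + t))

periodicRun-drop : ∀ {n p a L} x₀ {M} → x₀ + M ≤ L → PeriodicRun n p a L → PeriodicRun n p (a + x₀) M
periodicRun-drop {n} {p} {a} x₀ x₀+M≤L run t t<M =
  subst (Fixes2 ∘ Δ n p) (sym (ℕ.+-assoc a x₀ t)) (run (x₀ + t) (ℕ.<-≤-trans (ℕ.+-monoʳ-< x₀ t<M) x₀+M≤L))

-- Windows

Window : Set
Window = Vec (Vec (Maybe Perm) 4) 2

entry : Window → Fin 2 → Fin 4 → Maybe Perm
entry w c b = Vec.lookup (Vec.lookup w c) b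

window : ℕ → ℕ → ℕ → Window
window n q i = tabulate λ c → tabulate λ b → Δ n (toℕ c + q) (i + toℕ b)

window-entry : ∀ n q i c b → entry (window n q i) c b ≡ Δ n (toℕ c + q) (i + toℕ b)
window-entry n q i c b =
  trans (cong (λ row → Vec.lookup row b) (Vecₚ.lookup∘tabulate (λ c → tabulate λ b → Δ n (toℕ c + q) (i + toℕ b)) c))
        (Vecₚ.lookup∘tabulate (λ b → Δ n (toℕ c + q) (i + toℕ b)) b)

predict : Window → Digit → Fin 4 → Digit → Maybe Perm
predict w r b e = Maybe.map (conj e (e ⊕ r)) (entry w (carry e r) b)

predictAt : Window → Digit → Fin 2 → Fin 4 → Digit → Maybe Perm
predictAt w r  0F = predict w r
predictAt w 0F 1F = predict w 1F
predictAt w 1F 1F = predict w 2F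
-- The window one period further on; its second row is a dummy, never read since adding 0F never carries.
predictAt w 2F 1F = predict (replicate 2 (Vec.lookup w 1F)) 0F

-- The offsets d, d + 1, d + 2, d + 3, each written as 3 b + e.
cells : (Fin 4 → Digit → Maybe Perm) → Digit → Vec (Maybe Perm) 4
cells f 0F = f 0F 0F ∷ f 0F 1F ∷ f 0F 2F ∷ f 1F 0F ∷ []
cells f 1F = f 0F 1F ∷ f 0F 2F ∷ f 1F 0F ∷ f 1F 1F ∷ []
cells f 2F = f 0F 2F ∷ f 1F 0F ∷ f 1F 1F ∷ f 1F 2F ∷ []

step : Window → Digit → Digit → Window
step w r d = tabulate λ c → cells (predictAt w r c) d

predict-sound : ∀ n q i r b e →
                predict (window n q i) r b e ≡ Δ (suc n) (3 * q + toℕ r) (3 * (i + toℕ b) + toℕ e)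
predict-sound n q i r b e = begin
  Maybe.map (conj e (e ⊕ r)) (entry (window n q i) (carry e r) b)
    ≡⟨ cong (Maybe.map (conj e (e ⊕ r))) (window-entry n q i (carry e r) b) ⟩
  Maybe.map (conj e (e ⊕ r)) (Δ n (toℕ (carry e r) + q) (i + toℕ b))
    ≡⟨ Δ-descent n q r (i + toℕ b) e ⟨
  Δ (suc n) (3 * q + toℕ r) (3 * (i + toℕ b) + toℕ e)
    ∎
  where open ≡-Reasoning

predict-0F : ∀ w w′ b e → Vec.lookup w 0F ≡ Vec.lookup w′ 0F → predict w 0F b e ≡ predict w′ 0F b e
predict-0F w w′ b e eq rewrite carry-0F e | eq = refl

predictAt-sound : ∀ n q i r c b e →
                  predictAt (window n q i) r c b e ≡ Δ (suc n) (toℕ c + (3 * q + toℕ r)) (3 * (i + toℕ b) + toℕ e)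
predictAt-sound n q i r  0F b e = predict-sound n q i r b e
predictAt-sound n q i 0F 1F b e =
  trans (predict-sound n q i 1F b e) (cong (λ p → Δ (suc n) p (3 * (i + toℕ b) + toℕ e)) (ℕ.+-suc (3 * q) 0))
predictAt-sound n q i 1F 1F b e =
  trans (predict-sound n q i 2F b e) (cong (λ p → Δ (suc n) p (3 * (i + toℕ b) + toℕ e)) (ℕ.+-suc (3 * q) 1))
predictAt-sound n q i 2F 1F b e = begin
  predict (replicate 2 (Vec.lookup (window n q i) 1F)) 0F b e
    ≡⟨ predict-0F (replicate 2 (Vec.lookup (window n q i) 1F)) (window n (suc q) i) b e refl ⟩
  predict (window n (suc q) i) 0F b e
    ≡⟨ predict-sound n (suc q) i 0F b e ⟩
  Δ (suc n) (3 * suc q + 0) (3 * (i + toℕ b) + toℕ e)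
    ≡⟨ cong (λ p → Δ (suc n) p (3 * (i + toℕ b) + toℕ e)) (next q) ⟩
  Δ (suc n) (suc (3 * q + 2)) (3 * (i + toℕ b) + toℕ e)
    ∎
  where
  open ≡-Reasoning
  next : ∀ q → 3 * suc q + 0 ≡ suc (3 * q + 2)
  next = solve-∀

cells-tabulate : ∀ f (g : ℕ → Maybe Perm) → (∀ b e → f b e ≡ g (3 * toℕ b + toℕ e)) →
                 ∀ d → cells f d ≡ tabulate (λ t → g (toℕ d + toℕ t))
cells-tabulate f g f≗g 0F rewrite f≗g 0F 0F | f≗g 0F 1F | f≗g 0F 2F | f≗g 1F 0F = refl
cells-tabulate f g f≗g 1F rewrite f≗g 0F 1F | f≗g 0F 2F | f≗g 1F 0F | f≗g 1F 1F = refl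
cells-tabulate f g f≗g 2F rewrite f≗g 0F 2F | f≗g 1F 0F | f≗g 1F 1F | f≗g 1F 2F = refl

step-sound : ∀ n q i r d → window (suc n) (3 * q + toℕ r) (3 * i + toℕ d) ≡ step (window n q i) r d
step-sound n q i r d = Vecₚ.tabulate-cong λ c → sym (begin
  cells (predictAt (window n q i) r c) d
    ≡⟨ cells-tabulate _ (Δ′ c) (λ b e → trans (predictAt-sound n q i r c b e) (cong (Δ (suc n) _) (distrib i _ _))) d ⟩
  tabulate (λ t → Δ′ c (toℕ d + toℕ t))
    ≡⟨ Vecₚ.tabulate-cong (λ t → cong (Δ (suc n) (toℕ c + (3 * q + toℕ r))) (ℕ.+-assoc (3 * i) (toℕ d) (toℕ t))) ⟨
  tabulate (λ t → Δ (suc n) (toℕ c + (3 * q + toℕ r)) (3 * i + toℕ d + toℕ t))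
    ∎)
  where
  open ≡-Reasoning
  Δ′ : Fin 2 → ℕ → Maybe Perm
  Δ′ c x = Δ (suc n) (toℕ c + (3 * q + toℕ r)) (3 * i + x)
  distrib : ∀ i b e → 3 * (i + b) + e ≡ 3 * i + (3 * b + e)
  distrib = solve-∀

offset : Digit → Fin 10 → Fin 12
offset d t = inject≤ (toℕ d ↑ʳ t) (ℕ.+-monoˡ-≤ 10 (Finₚ.toℕ≤pred[n] d))

predictOffset : Window → Digit → Digit → Fin 10 → Maybe Perm
predictOffset w r d t = predict w r (quotient {4} 3 (offset d t)) (remainder {4} 3 (offset d t))

toℕ-offset : ∀ d t → toℕ (offset d t) ≡ toℕ d + toℕ t
toℕ-offset d t = trans (Finₚ.toℕ-inject≤ (toℕ d ↑ʳ t) _) (Finₚ.toℕ-↑ʳ (toℕ d) t)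

toℕ-remQuot : ∀ (k : Fin 12) → toℕ k ≡ 3 * toℕ (quotient {4} 3 k) + toℕ (remainder {4} 3 k)
toℕ-remQuot k = trans (cong toℕ (sym (Finₚ.combine-remQuot {4} 3 k))) (Finₚ.toℕ-combine (quotient {4} 3 k) _)

position-offset : ∀ i d t →
                  3 * (i + toℕ (quotient {4} 3 (offset d t))) + toℕ (remainder {4} 3 (offset d t)) ≡ 3 * i + toℕ d + toℕ t
position-offset i d t = begin
  3 * (i + toℕ b) + toℕ e       ≡⟨ distrib i (toℕ b) (toℕ e) ⟩
  3 * i + (3 * toℕ b + toℕ e)   ≡⟨ cong (3 * i +_) (toℕ-remQuot k) ⟨
  3 * i + toℕ k                 ≡⟨ cong (3 * i +_) (toℕ-offset d t) ⟩
  3 * i + (toℕ d + toℕ t)       ≡⟨ ℕ.+-assoc (3 * i) (toℕ d) (toℕ t) ⟨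
  3 * i + toℕ d + toℕ t         ∎
  where
  open ≡-Reasoning
  k = offset d t
  b = quotient {4} 3 k
  e = remainder {4} 3 k
  distrib : ∀ i b e → 3 * (i + b) + e ≡ 3 * i + (3 * b + e)
  distrib = solve-∀

predictOffset-sound : ∀ n q i r d t →
                      predictOffset (window n q i) r d t ≡ Δ (suc n) (3 * q + toℕ r) (3 * i + toℕ d + toℕ t)
predictOffset-sound n q i r d t = trans (predict-sound n q i r _ _) (cong (Δ (suc n) (3 * q + toℕ r)) (position-offset i d t))

BrokenWithin : ℕ → Window → Digit → Digit → Set
BrokenWithin B w r d = ∃ λ (t : Fin 10) → toℕ t ≤ B × ¬ Fixes2 (predictOffset w r d t)

brokenWithin? : ∀ B w r d → Dec (BrokenWithin B w r d)
brokenWithin? B w r d = Finₚ.any? λ t → (toℕ t ≤? B) ×-dec ¬? (fixes2? (predictOffset w r d t))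

-- Three consecutive matches for a period 3 q force the quotients at level n below them to be the identity.
TripleIdentity : Window → Set
TripleIdentity w = ∀ d → (∀ (t : Fin 3) → Fixes2 (predictOffset w 0F d (t ↑ˡ 7))) →
                   ∀ (t : Fin 3) → entry w 0F (quotient {4} 3 (offset d (t ↑ˡ 7))) ≡ just p123

tripleIdentity? : Decidable TripleIdentity
tripleIdentity? w =
  Finₚ.all? λ d → Finₚ.all? (λ t → fixes2? (predictOffset w 0F d (t ↑ˡ 7))) →-dec
                  Finₚ.all? (λ t → Maybeₚ.≡-dec Perms._≟_ (entry w 0F (quotient {4} 3 (offset d (t ↑ˡ 7)))) (just p123))

infix 4 _≟ʷ_ _∈?_
_≟ʷ_ : DecidableEquality Window
_≟ʷ_ = Vecₚ.≡-dec (Vecₚ.≡-dec (Maybeₚ.≡-dec Perms._≟_))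

-- Boolean folds normalise far faster than the Dec-valued any? and all?, so the checks run as folds.
_∈?_ : (w : Window) (ws : List Window) → Dec (w ∈ ws)
w ∈? ws = map′ (ListAny.map (λ {v} → toWitness {a? = w ≟ʷ v}) ∘ any⁻ _ ws)
               (any⁺ _ ∘ ListAny.map (λ {v} → fromWitness {a? = w ≟ʷ v}))
               (T? (any (λ v → isYes (w ≟ʷ v)) ws))

decideAll : ∀ {A : Set} {P : A → Set} (P? : Decidable P) xs → {T (all (isYes ∘ P?) xs)} → All P xs
decideAll P? xs {h} = All.map (λ {x} → toWitness {a? = P? x}) (all⁺ _ xs h)

win : (a₀ a₁ a₂ a₃ b₀ b₁ b₂ b₃ : Maybe Perm) → Window
win a₀ a₁ a₂ a₃ b₀ b₁ b₂ b₃ = (a₀ ∷ a₁ ∷ a₂ ∷ a₃ ∷ []) ∷ (b₀ ∷ b₁ ∷ b₂ ∷ b₃ ∷ []) ∷ []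

-- The windows reachable by step from window 0 0 0 and the empty window, found by exhaustive search.
reachable : List Window
reachable =
    win nothing nothing nothing nothing nothing nothing nothing nothing
  ∷ win (just p123) nothing nothing nothing nothing nothing nothing nothing
  ∷ win (just p123) (just p123) (just p123) nothing (just p213) (just p132) nothing nothing
  ∷ win (just p123) (just p123) nothing nothing (just p132) nothing nothing nothing
  ∷ win (just p213) (just p132) nothing nothing (just p231) nothing nothing nothing
  ∷ win (just p132) nothing nothing nothing nothing nothing nothing nothing
  ∷ win (just p231) nothing nothing nothing nothing nothing nothing nothing
  ∷ win (just p123) (just p123) (just p123) (just p123) (just p213) (just p132) (just p132) (just p213)
  ∷ win (just p123) (just p123) (just p123) (just p123) (just p132) (just p132) (just p213) (just p132)
  ∷ win (just p123) (just p123) (just p123) (just p123) (just p132) (just p213) (just p132) (just p213)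
  ∷ win (just p213) (just p132) (just p132) (just p213) (just p231) (just p123) (just p312) (just p231)
  ∷ win (just p132) (just p132) (just p213) (just p132) (just p123) (just p312) (just p231) (just p312)
  ∷ win (just p132) (just p213) (just p132) (just p213) (just p312) (just p231) (just p312) (just p123)
  ∷ win (just p231) (just p123) (just p312) (just p231) (just p213) (just p213) (just p321) (just p321)
  ∷ win (just p123) (just p312) (just p231) (just p312) (just p213) (just p321) (just p321) (just p132)
  ∷ win (just p312) (just p231) (just p312) (just p123) (just p321) (just p321) (just p132) (just p132)
  ∷ win (just p123) (just p123) (just p123) (just p123) (just p213) (just p132) (just p213) (just p213)
  ∷ win (just p123) (just p123) (just p123) (just p123) (just p132) (just p213) (just p213) (just p132)
  ∷ win (just p123) (just p123) (just p123) (just p123) (just p213) (just p213) (just p132) nothing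
  ∷ win (just p213) (just p132) (just p213) (just p213) (just p231) (just p312) (just p123) (just p231)
  ∷ win (just p132) (just p213) (just p213) (just p132) (just p312) (just p123) (just p231) nothing
  ∷ win (just p213) (just p213) (just p132) nothing (just p123) (just p231) nothing nothing
  ∷ win (just p231) (just p312) (just p123) (just p231) (just p321) (just p132) (just p132) nothing
  ∷ win (just p312) (just p123) (just p231) nothing (just p132) (just p132) nothing nothing
  ∷ win (just p123) (just p231) nothing nothing (just p132) nothing nothing nothing
  ∷ win (just p213) (just p213) (just p321) (just p321) (just p123) (just p231) (just p231) (just p231)
  ∷ win (just p213) (just p321) (just p321) (just p132) (just p231) (just p231) (just p231) (just p123)
  ∷ win (just p321) (just p321) (just p132) (just p132) (just p231) (just p231) (just p123) nothing
  ∷ win (just p123) (just p231) (just p231) (just p231) (just p132) (just p321) (just p321) (just p213)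
  ∷ win (just p231) (just p231) (just p231) (just p123) (just p321) (just p321) (just p213) nothing
  ∷ win (just p231) (just p231) (just p123) nothing (just p321) (just p213) nothing nothing
  ∷ win (just p132) (just p321) (just p321) (just p213) (just p312) (just p231) (just p312) nothing
  ∷ win (just p321) (just p321) (just p213) nothing (just p231) (just p312) nothing nothing
  ∷ win (just p321) (just p213) nothing nothing (just p312) nothing nothing nothing
  ∷ win (just p321) (just p132) (just p132) nothing (just p231) (just p123) nothing nothing
  ∷ win (just p132) (just p132) nothing nothing (just p123) nothing nothing nothing
  ∷ win (just p231) (just p123) nothing nothing (just p213) nothing nothing nothing
  ∷ win (just p213) nothing nothing nothing nothing nothing nothing nothing
  ∷ win (just p312) (just p231) (just p312) nothing (just p132) (just p213) nothing nothing
  ∷ win (just p231) (just p312) nothing nothing (just p213) nothing nothing nothing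
  ∷ win (just p312) nothing nothing nothing nothing nothing nothing nothing
  ∷ win (just p132) (just p213) nothing nothing (just p123) nothing nothing nothing
  ∷ win (just p123) (just p123) (just p123) (just p123) (just p213) (just p213) (just p132) (just p213)
  ∷ win (just p132) (just p213) (just p213) (just p132) (just p312) (just p123) (just p231) (just p312)
  ∷ win (just p213) (just p213) (just p132) (just p213) (just p123) (just p231) (just p312) (just p123)
  ∷ win (just p231) (just p312) (just p123) (just p231) (just p321) (just p132) (just p132) (just p321)
  ∷ win (just p312) (just p123) (just p231) (just p312) (just p132) (just p132) (just p321) (just p132)
  ∷ win (just p123) (just p231) (just p312) (just p123) (just p132) (just p321) (just p132) (just p132)
  ∷ win (just p123) (just p123) (just p123) (just p123) (just p213) (just p213) (just p132) (just p132)
  ∷ win (just p132) (just p213) (just p213) (just p132) (just p312) (just p123) (just p231) (just p123)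
  ∷ win (just p213) (just p213) (just p132) (just p132) (just p123) (just p231) (just p123) (just p312)
  ∷ win (just p231) (just p312) (just p123) (just p231) (just p321) (just p132) (just p132) (just p213)
  ∷ win (just p312) (just p123) (just p231) (just p123) (just p132) (just p132) (just p213) (just p213)
  ∷ win (just p123) (just p231) (just p123) (just p312) (just p132) (just p213) (just p213) (just p321)
  ∷ win (just p321) (just p321) (just p132) (just p132) (just p231) (just p231) (just p123) (just p312)
  ∷ win (just p231) (just p231) (just p231) (just p123) (just p321) (just p321) (just p213) (just p213)
  ∷ win (just p231) (just p231) (just p123) (just p312) (just p321) (just p213) (just p213) (just p132)
  ∷ win (just p132) (just p321) (just p321) (just p213) (just p312) (just p231) (just p312) (just p123)
  ∷ win (just p321) (just p321) (just p213) (just p213) (just p231) (just p312) (just p123) (just p123)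
  ∷ win (just p321) (just p213) (just p213) (just p132) (just p312) (just p123) (just p123) (just p123)
  ∷ win (just p321) (just p132) (just p132) (just p321) (just p231) (just p123) (just p312) (just p231)
  ∷ win (just p132) (just p132) (just p321) (just p132) (just p123) (just p312) (just p231) (just p123)
  ∷ win (just p132) (just p321) (just p132) (just p132) (just p312) (just p231) (just p123) (just p123)
  ∷ win (just p231) (just p123) (just p312) (just p231) (just p213) (just p213) (just p132) (just p213)
  ∷ win (just p123) (just p312) (just p231) (just p123) (just p213) (just p132) (just p213) (just p132)
  ∷ win (just p312) (just p231) (just p123) (just p123) (just p132) (just p213) (just p132) (just p213)
  ∷ win (just p213) (just p213) (just p132) (just p213) (just p123) (just p123) (just p123) (just p231)
  ∷ win (just p213) (just p132) (just p213) (just p132) (just p123) (just p123) (just p231) (just p312)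
  ∷ win (just p132) (just p213) (just p132) (just p213) (just p123) (just p231) (just p312) (just p231)
  ∷ win (just p321) (just p132) (just p132) (just p213) (just p231) (just p123) (just p123) (just p123)
  ∷ win (just p132) (just p132) (just p213) (just p213) (just p123) (just p123) (just p123) (just p231)
  ∷ win (just p132) (just p213) (just p213) (just p321) (just p123) (just p123) (just p231) (just p231)
  ∷ win (just p231) (just p123) (just p123) (just p123) (just p213) (just p132) (just p213) (just p132)
  ∷ win (just p123) (just p123) (just p123) (just p231) (just p132) (just p213) (just p132) (just p321)
  ∷ win (just p123) (just p123) (just p231) (just p231) (just p213) (just p132) (just p321) (just p321)
  ∷ win (just p213) (just p132) (just p213) (just p132) (just p231) (just p312) (just p231) (just p312)
  ∷ win (just p132) (just p213) (just p132) (just p321) (just p312) (just p231) (just p312) (just p231)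
  ∷ win (just p213) (just p132) (just p321) (just p321) (just p231) (just p312) (just p231) (just p312)
  ∷ win (just p312) (just p231) (just p312) (just p123) (just p132) (just p213) (just p132) (just p213)
  ∷ win (just p231) (just p312) (just p123) (just p123) (just p213) (just p132) (just p213) (just p132)
  ∷ win (just p312) (just p123) (just p123) (just p123) (just p132) (just p213) (just p132) (just p132)
  ∷ win (just p132) (just p213) (just p132) (just p213) (just p123) (just p123) (just p312) (just p231)
  ∷ win (just p213) (just p132) (just p213) (just p132) (just p123) (just p312) (just p231) (just p123)
  ∷ win (just p132) (just p213) (just p132) (just p132) (just p312) (just p231) (just p123) (just p312)
  ∷ win (just p123) (just p123) (just p312) (just p231) (just p213) (just p213) (just p321) (just p213)
  ∷ win (just p123) (just p312) (just p231) (just p123) (just p213) (just p321) (just p213) (just p213)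
  ∷ win (just p312) (just p231) (just p123) (just p312) (just p321) (just p213) (just p213) (just p321)
  ∷ win (just p123) (just p123) (just p123) (just p231) (just p213) (just p132) (just p132) (just p321)
  ∷ win (just p123) (just p123) (just p231) (just p312) (just p132) (just p132) (just p321) (just p321)
  ∷ win (just p123) (just p231) (just p312) (just p231) (just p132) (just p321) (just p321) (just p321)
  ∷ win (just p213) (just p132) (just p132) (just p321) (just p231) (just p123) (just p312) (just p312)
  ∷ win (just p132) (just p132) (just p321) (just p321) (just p123) (just p312) (just p312) (just p231)
  ∷ win (just p132) (just p321) (just p321) (just p321) (just p312) (just p312) (just p231) (just p231)
  ∷ win (just p231) (just p123) (just p312) (just p312) (just p213) (just p213) (just p321) (just p132)
  ∷ win (just p123) (just p312) (just p312) (just p231) (just p213) (just p321) (just p132) (just p321)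
  ∷ win (just p312) (just p312) (just p231) (just p231) (just p321) (just p132) (just p321) (just p213)
  ∷ win (just p231) (just p312) (just p231) (just p312) (just p321) (just p321) (just p321) (just p132)
  ∷ win (just p312) (just p231) (just p312) (just p231) (just p321) (just p321) (just p132) (just p213)
  ∷ win (just p231) (just p312) (just p231) (just p312) (just p321) (just p132) (just p213) (just p321)
  ∷ win (just p321) (just p321) (just p321) (just p132) (just p312) (just p231) (just p231) (just p123)
  ∷ win (just p321) (just p321) (just p132) (just p213) (just p231) (just p231) (just p123) (just p231)
  ∷ win (just p321) (just p132) (just p213) (just p321) (just p231) (just p123) (just p231) (just p231)
  ∷ win (just p312) (just p231) (just p231) (just p123) (just p132) (just p321) (just p213) (just p132)
  ∷ win (just p231) (just p231) (just p123) (just p231) (just p321) (just p213) (just p132) (just p321)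
  ∷ win (just p231) (just p123) (just p231) (just p231) (just p213) (just p132) (just p321) (just p213)
  ∷ win (just p123) (just p123) (just p123) (just p123) (just p132) (just p213) (just p132) (just p132)
  ∷ win (just p132) (just p132) (just p213) (just p132) (just p123) (just p312) (just p231) (just p123)
  ∷ win (just p231) (just p123) (just p312) (just p231) (just p213) (just p213) (just p321) (just p213)
  ∷ win (just p321) (just p321) (just p132) (just p132) (just p231) (just p231) (just p123) (just p123)
  ∷ win (just p231) (just p231) (just p231) (just p123) (just p321) (just p321) (just p213) (just p132)
  ∷ win (just p231) (just p231) (just p123) (just p123) (just p321) (just p213) (just p132) (just p213)
  ∷ win (just p132) (just p321) (just p321) (just p213) (just p312) (just p231) (just p312) (just p231)
  ∷ win (just p321) (just p321) (just p213) (just p132) (just p231) (just p312) (just p231) (just p312)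
  ∷ win (just p321) (just p213) (just p132) (just p213) (just p312) (just p231) (just p312) (just p231)
  ∷ win (just p132) (just p213) (just p213) (just p321) (just p123) (just p123) (just p231) (just p312)
  ∷ win (just p123) (just p123) (just p123) (just p231) (just p132) (just p213) (just p132) (just p213)
  ∷ win (just p123) (just p123) (just p231) (just p312) (just p213) (just p132) (just p213) (just p132)
  ∷ win (just p213) (just p132) (just p213) (just p132) (just p231) (just p312) (just p231) (just p123)
  ∷ win (just p132) (just p213) (just p132) (just p213) (just p312) (just p231) (just p123) (just p123)
  ∷ win (just p213) (just p132) (just p213) (just p132) (just p231) (just p123) (just p123) (just p123)
  ∷ win (just p213) (just p213) (just p321) (just p213) (just p123) (just p231) (just p312) (just p123)
  ∷ win (just p213) (just p321) (just p213) (just p213) (just p231) (just p312) (just p123) (just p231)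
  ∷ win (just p321) (just p213) (just p213) (just p321) (just p312) (just p123) (just p231) (just p231)
  ∷ win (just p123) (just p231) (just p312) (just p123) (just p132) (just p213) (just p132) (just p132)
  ∷ win (just p231) (just p312) (just p123) (just p231) (just p213) (just p132) (just p132) (just p321)
  ∷ win (just p312) (just p123) (just p231) (just p231) (just p132) (just p132) (just p321) (just p321)
  ∷ win (just p132) (just p213) (just p132) (just p132) (just p123) (just p123) (just p123) (just p312)
  ∷ win (just p213) (just p132) (just p132) (just p321) (just p123) (just p123) (just p312) (just p231)
  ∷ win (just p132) (just p132) (just p321) (just p321) (just p123) (just p312) (just p231) (just p312)
  ∷ win (just p312) (just p231) (just p312) (just p231) (just p132) (just p213) (just p321) (just p321)
  ∷ win (just p231) (just p312) (just p231) (just p312) (just p213) (just p321) (just p321) (just p321)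
  ∷ win (just p312) (just p231) (just p312) (just p231) (just p321) (just p321) (just p321) (just p213)
  ∷ win (just p132) (just p213) (just p321) (just p321) (just p123) (just p231) (just p231) (just p312)
  ∷ win (just p213) (just p321) (just p321) (just p321) (just p231) (just p231) (just p312) (just p312)
  ∷ win (just p321) (just p321) (just p321) (just p213) (just p231) (just p312) (just p312) (just p123)
  ∷ win (just p123) (just p231) (just p231) (just p312) (just p132) (just p321) (just p213) (just p321)
  ∷ win (just p231) (just p231) (just p312) (just p312) (just p321) (just p213) (just p321) (just p132)
  ∷ win (just p231) (just p312) (just p312) (just p123) (just p213) (just p321) (just p132) (just p132)
  ∷ win (just p231) (just p312) (just p231) (just p123) (just p321) (just p321) (just p213) (just p213)
  ∷ win (just p312) (just p231) (just p123) (just p123) (just p321) (just p213) (just p213) (just p132)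
  ∷ win (just p231) (just p123) (just p123) (just p123) (just p213) (just p213) (just p132) (just p213)
  ∷ win (just p321) (just p321) (just p213) (just p213) (just p312) (just p312) (just p123) (just p231)
  ∷ win (just p321) (just p213) (just p213) (just p132) (just p312) (just p123) (just p231) (just p312)
  ∷ win (just p312) (just p312) (just p123) (just p231) (just p321) (just p132) (just p132) (just p321)
  ∷ win (just p123) (just p123) (just p123) (just p312) (just p213) (just p132) (just p213) (just p132)
  ∷ win (just p123) (just p123) (just p312) (just p231) (just p132) (just p213) (just p132) (just p213)
  ∷ win (just p123) (just p312) (just p231) (just p312) (just p213) (just p132) (just p213) nothing
  ∷ win (just p213) (just p132) (just p213) (just p132) (just p231) (just p312) (just p123) (just p123)
  ∷ win (just p132) (just p213) (just p132) (just p213) (just p312) (just p123) (just p123) nothing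
  ∷ win (just p213) (just p132) (just p213) nothing (just p123) (just p123) nothing nothing
  ∷ win (just p231) (just p312) (just p123) (just p123) (just p321) (just p132) (just p132) nothing
  ∷ win (just p312) (just p123) (just p123) nothing (just p132) (just p132) nothing nothing
  ∷ win (just p213) (just p213) (just p321) (just p132) (just p123) (just p231) (just p231) (just p312)
  ∷ win (just p213) (just p321) (just p132) (just p321) (just p231) (just p231) (just p312) (just p312)
  ∷ win (just p321) (just p132) (just p321) (just p213) (just p231) (just p312) (just p312) (just p231)
  ∷ win (just p123) (just p231) (just p231) (just p312) (just p132) (just p321) (just p321) (just p321)
  ∷ win (just p231) (just p231) (just p312) (just p312) (just p321) (just p321) (just p321) (just p321)
  ∷ win (just p231) (just p312) (just p312) (just p231) (just p321) (just p321) (just p321) (just p321)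
  ∷ win (just p132) (just p321) (just p321) (just p321) (just p312) (just p231) (just p312) (just p312)
  ∷ win (just p321) (just p321) (just p321) (just p321) (just p231) (just p312) (just p312) (just p231)
  ∷ win (just p321) (just p321) (just p321) (just p321) (just p312) (just p312) (just p231) (just p312)
  ∷ win (just p132) (just p321) (just p213) (just p132) (just p312) (just p312) (just p231) (just p312)
  ∷ win (just p321) (just p213) (just p132) (just p321) (just p312) (just p231) (just p312) (just p312)
  ∷ win (just p213) (just p132) (just p321) (just p213) (just p231) (just p312) (just p312) (just p231)
  ∷ win (just p312) (just p312) (just p231) (just p312) (just p321) (just p321) (just p321) (just p321)
  ∷ win (just p312) (just p231) (just p312) (just p312) (just p321) (just p321) (just p321) (just p321)
  ∷ win (just p321) (just p321) (just p321) (just p321) (just p312) (just p231) (just p312) (just p312)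
  ∷ win (just p123) (just p312) (just p231) (just p312) (just p213) (just p132) (just p213) (just p321)
  ∷ win (just p132) (just p213) (just p132) (just p213) (just p312) (just p123) (just p123) (just p231)
  ∷ win (just p213) (just p132) (just p213) (just p321) (just p123) (just p123) (just p231) (just p231)
  ∷ win (just p231) (just p312) (just p123) (just p123) (just p321) (just p132) (just p132) (just p132)
  ∷ win (just p312) (just p123) (just p123) (just p231) (just p132) (just p132) (just p132) (just p321)
  ∷ win (just p123) (just p123) (just p231) (just p231) (just p132) (just p132) (just p321) (just p213)
  ∷ win (just p312) (just p231) (just p312) (just p312) (just p132) (just p213) (just p321) (just p132)
  ∷ win (just p231) (just p312) (just p312) (just p231) (just p213) (just p321) (just p132) (just p213)
  ∷ win (just p312) (just p312) (just p231) (just p312) (just p321) (just p132) (just p213) (just p321)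
  ∷ win (just p132) (just p213) (just p321) (just p132) (just p123) (just p231) (just p231) (just p123)
  ∷ win (just p213) (just p321) (just p132) (just p213) (just p231) (just p231) (just p123) (just p231)
  ∷ win (just p123) (just p231) (just p231) (just p123) (just p132) (just p321) (just p213) (just p132)
  ∷ win (just p312) (just p312) (just p231) (just p312) (just p321) (just p132) (just p213) (just p132)
  ∷ win (just p213) (just p321) (just p132) (just p213) (just p231) (just p231) (just p123) (just p123)
  ∷ win (just p321) (just p132) (just p213) (just p132) (just p231) (just p123) (just p123) (just p312)
  ∷ win (just p123) (just p231) (just p231) (just p123) (just p132) (just p321) (just p213) (just p213)
  ∷ win (just p231) (just p231) (just p123) (just p123) (just p321) (just p213) (just p213) (just p213)
  ∷ win (just p231) (just p123) (just p123) (just p312) (just p213) (just p213) (just p213) (just p321)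
  ∷ win (just p321) (just p132) (just p132) (just p132) (just p231) (just p123) (just p123) (just p312)
  ∷ win (just p132) (just p132) (just p132) (just p321) (just p123) (just p123) (just p312) (just p312)
  ∷ win (just p132) (just p132) (just p321) (just p213) (just p123) (just p312) (just p312) (just p231)
  ∷ win (just p231) (just p123) (just p123) (just p312) (just p213) (just p132) (just p213) (just p321)
  ∷ win (just p123) (just p123) (just p312) (just p312) (just p132) (just p213) (just p321) (just p321)
  ∷ win (just p123) (just p312) (just p312) (just p231) (just p213) (just p321) (just p321) (just p321)
  ∷ win (just p213) (just p132) (just p213) (just p321) (just p231) (just p312) (just p231) (just p312)
  ∷ win (just p132) (just p213) (just p321) (just p321) (just p312) (just p231) (just p312) (just p231)
  ∷ win (just p213) (just p321) (just p321) (just p321) (just p231) (just p312) (just p231) (just p312)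
  ∷ win (just p213) (just p132) (just p321) (just p213) (just p231) (just p312) (just p312) (just p123)
  ∷ win (just p312) (just p231) (just p312) (just p312) (just p321) (just p321) (just p321) (just p132)
  ∷ win (just p231) (just p312) (just p312) (just p123) (just p321) (just p321) (just p132) (just p213)
  ∷ win (just p321) (just p321) (just p321) (just p321) (just p312) (just p231) (just p312) (just p231)
  ∷ win (just p321) (just p321) (just p321) (just p132) (just p231) (just p312) (just p231) (just p312)
  ∷ win (just p321) (just p321) (just p132) (just p213) (just p312) (just p231) (just p312) (just p231)
  ∷ win (just p132) (just p321) (just p213) (just p213) (just p312) (just p312) (just p123) (just p123)
  ∷ win (just p321) (just p213) (just p213) (just p213) (just p312) (just p123) (just p123) (just p231)
  ∷ win (just p213) (just p213) (just p213) (just p321) (just p123) (just p123) (just p231) nothing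
  ∷ win (just p312) (just p312) (just p123) (just p123) (just p321) (just p132) (just p213) (just p132)
  ∷ win (just p312) (just p123) (just p123) (just p231) (just p132) (just p213) (just p132) nothing
  ∷ win (just p123) (just p123) (just p231) nothing (just p213) (just p132) nothing nothing
  ∷ win (just p321) (just p132) (just p213) (just p132) (just p231) (just p312) (just p231) nothing
  ∷ win (just p132) (just p213) (just p132) nothing (just p312) (just p231) nothing nothing
  ∷ win (just p132) (just p321) (just p213) (just p321) (just p312) (just p312) (just p231) (just p231)
  ∷ win (just p321) (just p213) (just p321) (just p132) (just p312) (just p231) (just p231) (just p123)
  ∷ win (just p213) (just p321) (just p132) (just p132) (just p231) (just p231) (just p123) (just p312)
  ∷ win (just p312) (just p312) (just p231) (just p231) (just p321) (just p321) (just p321) (just p213)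
  ∷ win (just p312) (just p231) (just p231) (just p123) (just p321) (just p321) (just p213) (just p213)
  ∷ win (just p321) (just p321) (just p321) (just p213) (just p312) (just p231) (just p312) (just p123)
  ∷ win (just p132) (just p321) (just p132) (just p132) (just p312) (just p231) (just p123) nothing
  ∷ win (just p123) (just p312) (just p231) (just p123) (just p213) (just p132) (just p213) nothing
  ∷ win (just p312) (just p231) (just p123) nothing (just p132) (just p213) nothing nothing
  ∷ win (just p213) (just p213) (just p132) (just p213) (just p123) (just p123) (just p123) nothing
  ∷ win (just p312) (just p123) (just p123) (just p123) (just p132) (just p213) (just p132) nothing
  ∷ win (just p213) (just p132) (just p213) (just p132) (just p123) (just p312) (just p231) nothing
  ∷ win (just p123) (just p123) (just p312) (just p231) (just p213) (just p213) (just p321) nothing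
  ∷ win (just p123) (just p312) (just p231) nothing (just p213) (just p321) nothing nothing
  ∷ win (just p312) (just p231) nothing nothing (just p321) nothing nothing nothing
  ∷ win (just p213) (just p213) (just p321) nothing (just p123) (just p231) nothing nothing
  ∷ win (just p213) (just p321) nothing nothing (just p231) nothing nothing nothing
  ∷ win (just p321) nothing nothing nothing nothing nothing nothing nothing
  ∷ win (just p231) (just p312) (just p231) (just p312) (just p321) (just p321) (just p213) (just p132)
  ∷ win (just p312) (just p231) (just p312) (just p231) (just p321) (just p213) (just p132) (just p213)
  ∷ win (just p231) (just p312) (just p231) (just p312) (just p213) (just p132) (just p213) (just p132)
  ∷ win (just p321) (just p321) (just p213) (just p132) (just p312) (just p312) (just p123) (just p123)
  ∷ win (just p321) (just p213) (just p132) (just p213) (just p312) (just p123) (just p123) (just p123)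
  ∷ win (just p213) (just p132) (just p213) (just p132) (just p123) (just p123) (just p123) (just p312)
  ∷ win (just p312) (just p312) (just p123) (just p123) (just p321) (just p132) (just p132) (just p213)
  ∷ win (just p312) (just p123) (just p123) (just p123) (just p132) (just p132) (just p213) (just p213)
  ∷ win (just p123) (just p123) (just p123) (just p312) (just p132) (just p213) (just p213) (just p321)
  ∷ win (just p312) (just p231) (just p312) (just p231) (just p132) (just p213) (just p132) (just p321)
  ∷ win (just p231) (just p312) (just p231) (just p312) (just p213) (just p132) (just p321) (just p321)
  ∷ win (just p312) (just p231) (just p312) (just p231) (just p132) (just p321) (just p321) nothing
  ∷ win (just p132) (just p213) (just p132) (just p321) (just p123) (just p123) (just p312) (just p312)
  ∷ win (just p213) (just p132) (just p321) (just p321) (just p123) (just p312) (just p312) nothing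
  ∷ win (just p132) (just p321) (just p321) nothing (just p312) (just p312) nothing nothing
  ∷ win (just p123) (just p123) (just p312) (just p312) (just p213) (just p213) (just p321) nothing
  ∷ win (just p123) (just p312) (just p312) nothing (just p213) (just p321) nothing nothing
  ∷ win (just p312) (just p312) nothing nothing (just p321) nothing nothing nothing
  ∷ win (just p231) (just p312) (just p231) nothing (just p321) (just p321) nothing nothing
  ∷ win (just p321) (just p321) nothing nothing (just p312) nothing nothing nothing
  ∷ win (just p321) (just p132) (just p132) (just p213) (just p231) (just p123) (just p312) (just p123)
  ∷ win (just p132) (just p132) (just p213) (just p213) (just p123) (just p312) (just p123) (just p231)
  ∷ win (just p132) (just p213) (just p213) (just p321) (just p312) (just p123) (just p231) nothing
  ∷ win (just p231) (just p123) (just p312) (just p123) (just p213) (just p213) (just p132) (just p132)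
  ∷ win (just p123) (just p312) (just p123) (just p231) (just p213) (just p132) (just p132) nothing
  ∷ win (just p213) (just p213) (just p132) (just p132) (just p123) (just p123) (just p123) nothing
  ∷ win (just p213) (just p132) (just p132) nothing (just p123) (just p123) nothing nothing
  ∷ win (just p123) (just p312) (just p231) (just p312) (just p213) (just p132) (just p213) (just p132)
  ∷ win (just p132) (just p213) (just p132) (just p213) (just p312) (just p123) (just p123) (just p123)
  ∷ win (just p231) (just p312) (just p123) (just p123) (just p321) (just p132) (just p132) (just p213)
  ∷ win (just p213) (just p213) (just p213) (just p321) (just p123) (just p123) (just p231) (just p312)
  ∷ win (just p312) (just p123) (just p123) (just p231) (just p132) (just p213) (just p132) (just p213)
  ∷ win (just p321) (just p132) (just p213) (just p132) (just p231) (just p312) (just p231) (just p123)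
  ∷ win (just p123) (just p231) (just p312) (just p231) (just p132) (just p321) (just p321) (just p213)
  ∷ win (just p132) (just p132) (just p321) (just p321) (just p123) (just p312) (just p312) (just p312)
  ∷ win (just p132) (just p321) (just p321) (just p213) (just p312) (just p312) (just p312) (just p123)
  ∷ win (just p231) (just p123) (just p312) (just p312) (just p213) (just p213) (just p321) (just p321)
  ∷ win (just p123) (just p312) (just p312) (just p312) (just p213) (just p321) (just p321) (just p132)
  ∷ win (just p312) (just p312) (just p312) (just p123) (just p321) (just p321) (just p132) (just p132)
  ∷ win (just p321) (just p213) (just p213) (just p321) (just p312) (just p123) (just p231) (just p312)
  ∷ win (just p231) (just p312) (just p123) (just p231) (just p213) (just p132) (just p132) (just p213)
  ∷ win (just p312) (just p123) (just p231) (just p312) (just p132) (just p132) (just p213) (just p132)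
  ∷ win (just p132) (just p213) (just p132) (just p132) (just p123) (just p123) (just p123) (just p123)
  ∷ win (just p213) (just p132) (just p132) (just p213) (just p123) (just p123) (just p123) (just p123)
  ∷ win (just p132) (just p132) (just p213) (just p132) (just p123) (just p123) (just p123) (just p123)
  ∷ win (just p213) (just p213) (just p321) (just p321) (just p123) (just p231) (just p312) (just p231)
  ∷ win (just p213) (just p321) (just p321) (just p132) (just p231) (just p312) (just p231) (just p123)
  ∷ win (just p321) (just p321) (just p132) (just p132) (just p312) (just p231) (just p123) (just p312)
  ∷ win (just p123) (just p231) (just p312) (just p231) (just p132) (just p213) (just p132) (just p213)
  ∷ win (just p231) (just p312) (just p231) (just p123) (just p213) (just p132) (just p213) (just p213)
  ∷ win (just p312) (just p231) (just p123) (just p312) (just p132) (just p213) (just p213) (just p132)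
  ∷ win (just p132) (just p213) (just p132) (just p213) (just p123) (just p123) (just p123) (just p123)
  ∷ win (just p213) (just p132) (just p213) (just p213) (just p123) (just p123) (just p123) (just p123)
  ∷ win (just p132) (just p213) (just p213) (just p132) (just p123) (just p123) (just p123) (just p123)
  ∷ win (just p132) (just p213) (just p213) (just p321) (just p312) (just p123) (just p231) (just p231)
  ∷ win (just p123) (just p312) (just p123) (just p231) (just p213) (just p132) (just p132) (just p321)
  ∷ win (just p213) (just p213) (just p132) (just p132) (just p123) (just p123) (just p123) (just p312)
  ∷ win (just p132) (just p321) (just p132) (just p132) (just p312) (just p231) (just p123) (just p312)
  ∷ win (just p123) (just p312) (just p231) (just p123) (just p213) (just p132) (just p213) (just p213)
  ∷ win (just p213) (just p213) (just p132) (just p213) (just p123) (just p123) (just p123) (just p123)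
  ∷ win (just p132) (just p213) (just p213) (just p321) (just p312) (just p123) (just p231) (just p312)
  ∷ win (just p123) (just p312) (just p123) (just p231) (just p213) (just p132) (just p132) (just p213)
  ∷ win (just p213) (just p213) (just p132) (just p132) (just p123) (just p123) (just p123) (just p123)
  ∷ win (just p312) (just p123) (just p123) (just p123) (just p132) (just p213) (just p132) (just p213)
  ∷ win (just p213) (just p132) (just p213) (just p132) (just p123) (just p312) (just p231) (just p312)
  ∷ win (just p123) (just p123) (just p312) (just p231) (just p213) (just p213) (just p321) (just p321)
  ∷ win (just p312) (just p231) (just p312) (just p231) (just p132) (just p321) (just p321) (just p213)
  ∷ win (just p213) (just p132) (just p321) (just p321) (just p123) (just p312) (just p312) (just p312)
  ∷ win (just p123) (just p123) (just p312) (just p312) (just p213) (just p213) (just p321) (just p321)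
  ∷ win (just p231) (just p123) (just p123) (just p123) (just p213) (just p213) (just p132) (just p132)
  ∷ win (just p321) (just p213) (just p213) (just p132) (just p312) (just p123) (just p231) (just p123)
  ∷ win (just p312) (just p312) (just p123) (just p231) (just p321) (just p132) (just p132) (just p213)
  ∷ win (just p321) (just p321) (just p132) (just p132) (just p312) (just p231) (just p123) (just p123)
  ∷ win (just p231) (just p312) (just p231) (just p123) (just p213) (just p132) (just p213) (just p132)
  ∷ win (just p132) (just p213) (just p132) (just p213) (just p123) (just p123) (just p123) (just p231)
  ∷ win (just p231) (just p312) (just p231) (just p312) (just p321) (just p132) (just p213) (just p132)
  ∷ win (just p321) (just p321) (just p132) (just p213) (just p231) (just p231) (just p123) (just p123)
  ∷ win (just p312) (just p231) (just p231) (just p123) (just p132) (just p321) (just p213) (just p213)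
  ∷ win (just p132) (just p132) (just p321) (just p213) (just p123) (just p312) (just p312) (just p123)
  ∷ win (just p123) (just p123) (just p312) (just p312) (just p132) (just p213) (just p321) (just p132)
  ∷ win (just p123) (just p312) (just p312) (just p123) (just p213) (just p321) (just p132) (just p213)
  ∷ win (just p213) (just p132) (just p213) (just p321) (just p231) (just p312) (just p231) (just p231)
  ∷ win (just p132) (just p213) (just p321) (just p132) (just p312) (just p231) (just p231) (just p312)
  ∷ win (just p213) (just p321) (just p132) (just p213) (just p231) (just p231) (just p312) (just p231)
  ∷ win (just p231) (just p312) (just p231) (just p231) (just p321) (just p321) (just p321) (just p321)
  ∷ win (just p312) (just p231) (just p231) (just p312) (just p321) (just p321) (just p321) (just p321)
  ∷ win (just p231) (just p231) (just p312) (just p231) (just p321) (just p321) (just p321) (just p213)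
  ∷ win (just p321) (just p321) (just p321) (just p321) (just p312) (just p231) (just p231) (just p312)
  ∷ win (just p321) (just p321) (just p321) (just p321) (just p231) (just p231) (just p312) (just p312)
  ∷ win (just p312) (just p231) (just p231) (just p312) (just p132) (just p321) (just p213) (just p321)
  ∷ win (just p312) (just p231) (just p312) (just p231) (just p321) (just p321) (just p321) (just p321)
  ∷ win (just p213) (just p321) (just p321) (just p321) (just p231) (just p231) (just p312) (just p231)
  ∷ win (just p321) (just p321) (just p321) (just p321) (just p231) (just p312) (just p231) (just p231)
  ∷ win (just p123) (just p231) (just p231) (just p312) (just p132) (just p321) (just p213) (just p132)
  ∷ win (just p231) (just p231) (just p312) (just p231) (just p321) (just p213) (just p132) (just p321)
  ∷ win (just p231) (just p312) (just p231) (just p231) (just p213) (just p132) (just p321) (just p213)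
  ∷ win (just p132) (just p321) (just p213) (just p132) (just p312) (just p312) (just p123) (just p312)
  ∷ win (just p321) (just p213) (just p132) (just p321) (just p312) (just p123) (just p312) (just p312)
  ∷ win (just p213) (just p132) (just p321) (just p213) (just p123) (just p312) (just p312) (just p231)
  ∷ win (just p312) (just p312) (just p123) (just p312) (just p321) (just p132) (just p213) (just p321)
  ∷ win (just p312) (just p123) (just p312) (just p312) (just p132) (just p213) (just p321) (just p321)
  ∷ win (just p321) (just p132) (just p213) (just p321) (just p231) (just p312) (just p231) (just p312)
  ∷ win (just p231) (just p312) (just p231) (just p312) (just p213) (just p132) (just p213) (just p321)
  ∷ win (just p321) (just p213) (just p132) (just p213) (just p312) (just p123) (just p123) (just p231)
  ∷ win (just p312) (just p312) (just p123) (just p123) (just p321) (just p132) (just p132) (just p132)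
  ∷ win (just p213) (just p213) (just p213) (just p321) (just p123) (just p123) (just p231) (just p231)
  ∷ win (just p312) (just p123) (just p123) (just p231) (just p132) (just p213) (just p132) (just p321)
  ∷ win (just p321) (just p132) (just p213) (just p132) (just p231) (just p312) (just p231) (just p312)
  ∷ win (just p321) (just p132) (just p321) (just p213) (just p231) (just p312) (just p312) (just p123)
  ∷ win (just p231) (just p231) (just p312) (just p312) (just p321) (just p321) (just p321) (just p132)
  ∷ win (just p132) (just p321) (just p321) (just p321) (just p312) (just p231) (just p312) (just p231)
  ∷ win (just p312) (just p231) (just p312) (just p231) (just p132) (just p321) (just p321) (just p321)
  ∷ win (just p213) (just p132) (just p321) (just p321) (just p123) (just p312) (just p312) (just p231)
  ∷ win (just p123) (just p123) (just p312) (just p312) (just p213) (just p213) (just p321) (just p132)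
  ∷ win (just p213) (just p132) (just p321) (just p213) (just p123) (just p312) (just p312) (just p123)
  ∷ win (just p312) (just p123) (just p312) (just p312) (just p132) (just p213) (just p321) (just p132)
  ∷ win (just p321) (just p132) (just p213) (just p321) (just p231) (just p312) (just p231) (just p231)
  ∷ win (just p213) (just p321) (just p132) (just p132) (just p231) (just p231) (just p123) (just p123)
  ∷ win (just p312) (just p231) (just p231) (just p123) (just p321) (just p321) (just p213) (just p132)
  ∷ win (just p321) (just p321) (just p321) (just p213) (just p312) (just p231) (just p312) (just p231)
  ∷ win (just p231) (just p231) (just p312) (just p231) (just p321) (just p321) (just p321) (just p321)
  ∷ win (just p321) (just p321) (just p321) (just p321) (just p231) (just p231) (just p312) (just p231)
  ∷ win (just p312) (just p231) (just p231) (just p312) (just p132) (just p321) (just p213) (just p132)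
  ∷ win (just p231) (just p312) (just p231) (just p312) (just p321) (just p132) (just p213) nothing
  ∷ win (just p321) (just p321) (just p132) (just p213) (just p231) (just p231) (just p123) nothing
  ∷ win (just p321) (just p132) (just p213) nothing (just p231) (just p123) nothing nothing
  ∷ win (just p312) (just p231) (just p231) (just p123) (just p132) (just p321) (just p213) nothing
  ∷ win (just p321) (just p132) (just p321) (just p213) (just p231) (just p312) (just p312) nothing
  ∷ win (just p231) (just p231) (just p312) (just p312) (just p321) (just p321) (just p321) nothing
  ∷ win (just p231) (just p312) (just p312) nothing (just p321) (just p321) nothing nothing
  ∷ win (just p132) (just p321) (just p321) (just p321) (just p312) (just p231) (just p312) nothing
  ∷ win (just p321) (just p321) (just p321) nothing (just p231) (just p312) nothing nothing
  ∷ win (just p132) (just p321) (just p213) nothing (just p312) (just p312) nothing nothing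
  ∷ win (just p231) (just p231) (just p312) (just p231) (just p321) (just p321) (just p321) nothing
  ∷ win (just p321) (just p321) (just p321) (just p321) (just p231) (just p231) (just p312) nothing
  ∷ win (just p312) (just p231) (just p231) (just p312) (just p132) (just p321) (just p213) nothing
  ∷ win (just p231) (just p231) (just p312) nothing (just p321) (just p213) nothing nothing
  ∷ win (just p213) (just p132) (just p321) (just p213) (just p123) (just p312) (just p312) nothing
  ∷ win (just p312) (just p123) (just p312) (just p312) (just p132) (just p213) (just p321) nothing
  ∷ win (just p321) (just p132) (just p213) (just p321) (just p231) (just p312) (just p231) nothing
  ∷ win (just p132) (just p213) (just p321) nothing (just p312) (just p231) nothing nothing
  ∷ []

-- The windows of period 0, reachable by step _ 0F from the same two.
reachable₀ : List Window
reachable₀ =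
    win nothing nothing nothing nothing nothing nothing nothing nothing
  ∷ win (just p123) nothing nothing nothing nothing nothing nothing nothing
  ∷ win (just p123) (just p123) (just p123) nothing (just p213) (just p132) nothing nothing
  ∷ win (just p123) (just p123) nothing nothing (just p132) nothing nothing nothing
  ∷ win (just p123) (just p123) (just p123) (just p123) (just p213) (just p132) (just p132) (just p213)
  ∷ win (just p123) (just p123) (just p123) (just p123) (just p132) (just p132) (just p213) (just p132)
  ∷ win (just p123) (just p123) (just p123) (just p123) (just p132) (just p213) (just p132) (just p213)
  ∷ win (just p123) (just p123) (just p123) (just p123) (just p213) (just p132) (just p213) (just p213)
  ∷ win (just p123) (just p123) (just p123) (just p123) (just p132) (just p213) (just p213) (just p132)
  ∷ win (just p123) (just p123) (just p123) (just p123) (just p213) (just p213) (just p132) nothing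
  ∷ win (just p123) (just p123) (just p123) (just p123) (just p213) (just p213) (just p132) (just p213)
  ∷ win (just p123) (just p123) (just p123) (just p123) (just p213) (just p213) (just p132) (just p132)
  ∷ win (just p123) (just p123) (just p123) (just p123) (just p132) (just p213) (just p132) (just p132)
  ∷ []
reachable-closed : All (λ w → ∀ r d → step w r d ∈ reachable) reachable
reachable-closed = decideAll (λ w → Finₚ.all? λ r → Finₚ.all? λ d → step w r d ∈? reachable) reachable

reachable₀-closed : All (λ w → ∀ d → step w 0F d ∈ reachable₀) reachable₀
reachable₀-closed = decideAll (λ w → Finₚ.all? λ d → step w 0F d ∈? reachable₀) reachable₀

reachable-tripleIdentity : All TripleIdentity reachable
reachable-tripleIdentity = decideAll tripleIdentity? reachable

successors : Digit → List Window → List Window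
successors r = concatMap (λ w → map (step w r) (allFin 3))

-- Windows that may occur for period q: the small periods need sharper run bounds than reachable allows.
candidates : ℕ → List Window
candidates 0 = reachable₀
candidates 1 = successors 1F reachable₀
candidates 2 = successors 2F reachable₀
candidates 3 = successors 0F (candidates 1)
candidates (suc (suc (suc (suc _)))) = reachable

-- For the period 3 q + r + 1, which is not divisible by 3.
runBound : ℕ → Fin 2 → ℕ
runBound 0 0F = 0
runBound 0 1F = 1
runBound 1 _  = 3
runBound 2 0F = 5
runBound 2 1F = 6
runBound 3 0F = 7
runBound _ _  = 8

ShortRuns : ℕ → Window → Set
ShortRuns q w = ∀ r d → BrokenWithin (runBound q r) w (Fin.suc r) d

shortRuns? : ∀ q → Decidable (ShortRuns q)
shortRuns? q w = Finₚ.all? λ r → Finₚ.all? λ d → brokenWithin? (runBound q r) w (Fin.suc r) d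

candidates-shortRuns : ∀ q → All (ShortRuns q) (candidates q)
candidates-shortRuns 0 = decideAll (shortRuns? 0) (candidates 0)
candidates-shortRuns 1 = decideAll (shortRuns? 1) (candidates 1)
candidates-shortRuns 2 = decideAll (shortRuns? 2) (candidates 2)
candidates-shortRuns 3 = decideAll (shortRuns? 3) (candidates 3)
candidates-shortRuns (suc (suc (suc (suc q)))) = decideAll (shortRuns? 4) reachable

blank : Window
blank = replicate 2 (replicate 4 nothing)

window₀-blank : ∀ q i → window 0 (suc q) i ≡ blank
window₀-blank q zero    = refl
window₀-blank q (suc i) = refl

window₀-∈ : ∀ {ws} → window 0 0 0 ∈ ws → blank ∈ ws → ∀ q i → window 0 q i ∈ ws
window₀-∈      seed∈ _      zero    zero    = seed∈
window₀-∈      _     blank∈ zero    (suc i) = blank∈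
window₀-∈ {ws} _     blank∈ (suc q) i       = subst (_∈ ws) (sym (window₀-blank q i)) blank∈

step-∈-successors : ∀ {w ws} r d → w ∈ ws → step w r d ∈ successors r ws
step-∈-successors r d w∈ws =
  ∈-concatMap⁺ (λ w → map (step w r) (allFin 3)) (ListAny.map (λ { refl → ∈-map⁺ (step _ r) (∈-allFin d) }) w∈ws)

window∈reachable : ∀ n q i → window n q i ∈ reachable
window∈reachable zero q i = window₀-∈ (there (here refl)) (here refl) q i
window∈reachable (suc n) q i with base3 q | base3 i
... | q′ ·3+ r | i′ ·3+ d = subst (_∈ reachable) (sym (step-sound n q′ i′ r d))
                                  (All.lookup reachable-closed (window∈reachable n q′ i′) r d)

window∈reachable₀ : ∀ n i → window n 0 i ∈ reachable₀
window∈reachable₀ zero i = window₀-∈ (there (here refl)) (here refl) 0 i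
window∈reachable₀ (suc n) i with base3 i
... | i′ ·3+ d = subst (_∈ reachable₀) (sym (step-sound n 0 i′ 0F d))
                       (All.lookup reachable₀-closed (window∈reachable₀ n i′) d)

window∈candidates : ∀ n q i → window n q i ∈ candidates q
window∈candidates n       0 i = window∈reachable₀ n i
window∈candidates zero    1 i = subst (_∈ candidates 1) (sym (window₀-blank 0 i))
                                      (step-∈-successors {blank} {reachable₀} 1F 0F (here refl))
window∈candidates zero    2 i = subst (_∈ candidates 2) (sym (window₀-blank 1 i))
                                      (step-∈-successors {blank} {reachable₀} 2F 0F (here refl))
window∈candidates zero    3 i = subst (_∈ candidates 3) (sym (window₀-blank 2 i))
                                      (step-∈-successors 0F 0F (window∈candidates zero 1 0))
window∈candidates (suc n) 1 i with base3 i
... | i′ ·3+ d = subst (_∈ candidates 1) (sym (step-sound n 0 i′ 1F d)) (step-∈-successors 1F d (window∈reachable₀ n i′))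
window∈candidates (suc n) 2 i with base3 i
... | i′ ·3+ d = subst (_∈ candidates 2) (sym (step-sound n 0 i′ 2F d)) (step-∈-successors 2F d (window∈reachable₀ n i′))
window∈candidates (suc n) 3 i with base3 i
... | i′ ·3+ d = subst (_∈ candidates 3) (sym (step-sound n 1 i′ 0F d)) (step-∈-successors 0F d (window∈candidates n 1 i′))
window∈candidates n (suc (suc (suc (suc q)))) i = window∈reachable n (suc (suc (suc (suc q)))) i

-- Periodic runs

periodicRun-≤ : ∀ {n q i r d B L} → BrokenWithin B (window n q i) r d →
                PeriodicRun (suc n) (3 * q + toℕ r) (3 * i + toℕ d) L → L ≤ B
periodicRun-≤ {n} {q} {i} {r} {d} (t , t≤B , broken) run = ℕ.≮⇒≥ λ B<L →
  broken (subst Fixes2 (sym (predictOffset-sound n q i r d t)) (run (toℕ t) (ℕ.≤-<-trans t≤B B<L)))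

runBound-fits : ∀ q r → 4 * runBound q r ≤ 3 * (3 * q + toℕ (Fin.suc r))
runBound-fits 0 0F = z≤n
runBound-fits 0 1F = ℕ.≤ᵇ⇒≤ 4 6 _
runBound-fits 1 0F = ℕ.≤ᵇ⇒≤ 12 12 _
runBound-fits 1 1F = ℕ.≤ᵇ⇒≤ 12 15 _
runBound-fits 2 0F = ℕ.≤ᵇ⇒≤ 20 21 _
runBound-fits 2 1F = ℕ.≤ᵇ⇒≤ 24 24 _
runBound-fits 3 0F = ℕ.≤ᵇ⇒≤ 28 30 _
runBound-fits 3 1F = ℕ.≤ᵇ⇒≤ 32 33 _
runBound-fits (suc (suc (suc (suc q)))) r = ℕ.≤-trans (ℕ.≤ᵇ⇒≤ 32 36 _)
  (ℕ.*-monoʳ-≤ 3 (ℕ.≤-trans (ℕ.*-monoʳ-≤ 3 (ℕ.m≤m+n 4 q)) (ℕ.m≤m+n _ _)))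

periodicRun-short : ∀ n q r i d L → PeriodicRun (suc n) (3 * q + toℕ (Fin.suc r)) (3 * i + toℕ d) L →
                    4 * L ≤ 3 * (3 * q + toℕ (Fin.suc r))
periodicRun-short n q r i d L run = ℕ.≤-trans (ℕ.*-monoʳ-≤ 4 L≤bound) (runBound-fits q r)
  where
  L≤bound = periodicRun-≤ {n} {q} {i} {Fin.suc r} {d}
                          (All.lookup (candidates-shortRuns q) (window∈candidates n q i) r d) run

triple-identity : ∀ n q a → PeriodicRun (suc n) (3 * q + 0) a 3 → ∀ t → t < 3 → Δ n q ((a + t) / 3) ≡ just p123
triple-identity n q a run t t<3 with base3 a
... | i ·3+ d = begin
  Δ n q ((3 * i + toℕ d + t) / 3)          ≡⟨ cong (λ x → Δ n q (x / 3)) position ⟨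
  Δ n q ((3 * (i + toℕ b) + toℕ e) / 3)    ≡⟨ cong (Δ n q) ([3q+d]/3≡q (i + toℕ b) e) ⟩
  Δ n q (i + toℕ b)                        ≡⟨ window-entry n q i 0F b ⟨
  entry (window n q i) 0F b                ≡⟨ All.lookup reachable-tripleIdentity (window∈reachable n q i) d fixes (fromℕ< t<3) ⟩
  just p123                                ∎
  where
  open ≡-Reasoning
  t′ = fromℕ< t<3 ↑ˡ 7
  b = quotient {4} 3 (offset d t′)
  e = remainder {4} 3 (offset d t′)
  position : 3 * (i + toℕ b) + toℕ e ≡ 3 * i + toℕ d + t
  position = trans (position-offset i d t′) (cong (3 * i + toℕ d +_) (trans (Finₚ.toℕ-↑ˡ (fromℕ< t<3) 7) (Finₚ.toℕ-fromℕ< t<3)))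
  fixes : ∀ (s : Fin 3) → Fixes2 (predictOffset (window n q i) 0F d (s ↑ˡ 7))
  fixes s = subst Fixes2 (sym (trans (predictOffset-sound n q i 0F d (s ↑ˡ 7))
                                     (cong (λ x → Δ (suc n) (3 * q + 0) (3 * i + toℕ d + x)) (Finₚ.toℕ-↑ˡ s 7))))
                  (run (toℕ s) (Finₚ.toℕ<n s))

triple-around : ∀ {x L} → 3 ≤ L → x < L → ∃₂ λ x₀ t → x₀ + t ≡ x × t < 3 × x₀ + 3 ≤ L
triple-around {x} {L} 3≤L x<L with x + 3 ≤? L
... | yes x+3≤L = x , 0 , ℕ.+-identityʳ x , z<s , x+3≤L
... | no  x+3≰L = L ∸ 3 , x ∸ (L ∸ 3) , ℕ.m+[n∸m]≡n L∸3≤x , t<3 , ℕ.≤-reflexive (ℕ.m∸n+n≡m 3≤L)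
  where
  L∸3≤x : L ∸ 3 ≤ x
  L∸3≤x = subst (L ∸ 3 ≤_) (ℕ.m+n∸n≡m x 3) (ℕ.∸-monoˡ-≤ 3 (ℕ.<⇒≤ (ℕ.≰⇒> x+3≰L)))
  t<3 : x ∸ (L ∸ 3) < 3
  t<3 = ℕ.+-cancelˡ-< (L ∸ 3) _ _ (subst₂ _<_ (sym (ℕ.m+[n∸m]≡n L∸3≤x)) (sym (ℕ.m∸n+n≡m 3≤L)) x<L)

identity-run : ∀ {n q i d L K} → 3 ≤ L → (∀ {s} → s < K → 3 * s < L) →
               PeriodicRun (suc n) (3 * q + 0) (3 * i + toℕ d) L → PeriodicRun n q i K
identity-run {n} {q} {i} {d} {L} 3≤L below run s s<K with triple-around 3≤L (below s<K)
... | x₀ , t , x₀+t≡3s , t<3 , x₀+3≤L =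
  subst Fixes2 (cong (Δ n q) target) (fixes2-of-identity (triple-identity n q (3 * i + toℕ d + x₀) triple t t<3))
  where
  triple = periodicRun-drop {suc n} {3 * q + 0} {3 * i + toℕ d} {L} x₀ x₀+3≤L run
  regroup : ∀ i d s → 3 * i + d + 3 * s ≡ 3 * (i + s) + d
  regroup = solve-∀
  target : (3 * i + toℕ d + x₀ + t) / 3 ≡ i + s
  target = begin
    (3 * i + toℕ d + x₀ + t) / 3   ≡⟨ cong (_/ 3) (trans (ℕ.+-assoc (3 * i + toℕ d) x₀ t) (cong (3 * i + toℕ d +_) x₀+t≡3s)) ⟩
    (3 * i + toℕ d + 3 * s) / 3    ≡⟨ cong (_/ 3) (regroup i (toℕ d) s) ⟩
    (3 * (i + s) + toℕ d) / 3      ≡⟨ [3q+d]/3≡q (i + s) d ⟩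
    i + s                          ∎
    where open ≡-Reasoning

ceil-third : ∀ L → ∃ λ K → L ≤ 3 * K × (∀ {s} → s < K → 3 * s < L)
ceil-third L with base3 L
... | m ·3+ 0F = m , ℕ.≤-reflexive (ℕ.+-identityʳ (3 * m)) ,
                 λ s<m → ℕ.<-≤-trans (ℕ.*-monoʳ-< 3 s<m) (ℕ.m≤m+n (3 * m) 0)
... | m ·3+ Fin.suc d = suc m , 3m+d≤3[1+m] ,
                        λ s<1+m → ℕ.≤-<-trans (ℕ.*-monoʳ-≤ 3 (s≤s⁻¹ s<1+m)) (ℕ.m<m+n (3 * m) z<s)
  where
  3m+d≤3[1+m] : 3 * m + suc (toℕ d) ≤ 3 * suc m
  3m+d≤3[1+m] = subst (3 * m + suc (toℕ d) ≤_) (trans (ℕ.+-comm (3 * m) 3) (sym (ℕ.*-suc 3 m)))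
                      (ℕ.+-monoʳ-≤ (3 * m) (Finₚ.toℕ≤n (Fin.suc d)))

periodicRun-triple : ∀ n q i d L → 1 ≤ q → (∀ a K → PeriodicRun n q a K → 4 * K ≤ 3 * q) →
                     PeriodicRun (suc n) (3 * q + 0) (3 * i + toℕ d) L → 4 * L ≤ 3 * (3 * q + 0)
periodicRun-triple n q i d L 1≤q bound run with L ≤? 2
... | yes L≤2 = begin
  4 * L             ≤⟨ ℕ.*-monoʳ-≤ 4 L≤2 ⟩
  8                 ≤⟨ ℕ.≤ᵇ⇒≤ 8 9 _ ⟩
  3 * (3 * 1 + 0)   ≤⟨ ℕ.*-monoʳ-≤ 3 (ℕ.+-monoˡ-≤ 0 (ℕ.*-monoʳ-≤ 3 1≤q)) ⟩
  3 * (3 * q + 0)   ∎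
  where open ℕ.≤-Reasoning
... | no L≰2 with ceil-third L
...   | K , L≤3K , below = begin
  4 * L             ≤⟨ ℕ.*-monoʳ-≤ 4 L≤3K ⟩
  4 * (3 * K)       ≡⟨ swap K ⟩
  3 * (4 * K)       ≤⟨ ℕ.*-monoʳ-≤ 3 (bound i K (identity-run {n} {q} {i} {d} (ℕ.≰⇒> L≰2) below run)) ⟩
  3 * (3 * q)       ≡⟨ cong (3 *_) (ℕ.+-identityʳ (3 * q)) ⟨
  3 * (3 * q + 0)   ∎
  where
  open ℕ.≤-Reasoning
  swap : ∀ K → 4 * (3 * K) ≡ 3 * (4 * K)
  swap = solve-∀

1≤3q⇒1≤q : ∀ q → 1 ≤ 3 * q + 0 → 1 ≤ q
1≤3q⇒1≤q (suc q) _ = s≤s z≤n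

periodicRun-bound : ∀ n p → 1 ≤ p → ∀ a L → PeriodicRun n p a L → 4 * L ≤ 3 * p
periodicRun-bound zero    (suc p) _ a zero    _   = z≤n
periodicRun-bound zero    (suc p) _ a (suc L) run = contradiction (subst Fixes2 (Δ-zero p (a + 0)) (run 0 z<s)) λ ()
periodicRun-bound (suc n) p 1≤p a L run with base3 p | base3 a
... | q ·3+ 0F        | i ·3+ d = periodicRun-triple n q i d L 1≤q (periodicRun-bound n q 1≤q) run
  where 1≤q = 1≤3q⇒1≤q q 1≤p
... | q ·3+ Fin.suc r | i ·3+ d = periodicRun-short n q r i d L run

-- Factors of φ^n(2)

letter-at : ∀ n u x v {t} → u ++ x ++ v ≡ φ^ n [ l2 ] → (t<n : t < length x) →
            Maybe.map letter (Φ n !? (length u + t)) ≡ just (lookup x (fromℕ< t<n))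
letter-at n u x v {t} eq t<n = begin
  Maybe.map letter (Φ n !? (length u + t))   ≡⟨ map-!? letter (Φ n) (length u + t) ⟨
  map letter (Φ n) !? (length u + t)         ≡⟨ cong (_!? (length u + t)) (trans (sym (φ^≡letters n)) (sym eq)) ⟩
  (u ++ x ++ v) !? (length u + t)            ≡⟨ !?-++ʳ u (x ++ v) t ⟩
  (x ++ v) !? t                              ≡⟨ !?-++ˡ x v t<n ⟩
  x !? t                                     ≡⟨ !?-lookup x t<n ⟩
  just (lookup x (fromℕ< t<n))               ∎
  where open ≡-Reasoning

factor-periodicRun : ∀ n u x v {p} → u ++ x ++ v ≡ φ^ n [ l2 ] → HasPeriod x p →
                     PeriodicRun n p (length u) (length x ∸ p)
factor-periodicRun n u x v {p} eq (_ , p≤m , period) t t<m∸p =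
  fixes2-of-equal-letters (letter-at n u x v eq t<m) (begin
    Maybe.map letter (Φ n !? (length u + t + p))   ≡⟨ cong (Maybe.map letter ∘ (Φ n !?_)) (ℕ.+-assoc (length u) t p) ⟩
    Maybe.map letter (Φ n !? (length u + (t + p))) ≡⟨ letter-at n u x v eq t+p<m ⟩
    just (lookup x (fromℕ< t+p<m))                 ≡⟨ cong just (period t t+p<m) ⟨
    just (lookup x (fromℕ< t<m))                   ∎)
  where
  open ≡-Reasoning
  t+p<m : t + p < length x
  t+p<m = subst (t + p <_) (ℕ.m∸n+n≡m p≤m) (ℕ.+-monoˡ-< p t<m∸p)
  t<m : t < length x
  t<m = ℕ.≤-trans (ℕ.m≤m+n (suc t) p) t+p<m

factor-exponent : ∀ n u x v {p} → u ++ x ++ v ≡ φ^ n [ l2 ] → HasPeriod x p → 4 * length x ≤ 7 * p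
factor-exponent n u x v {p} eq period@(1≤p , p≤m , _) = begin
  4 * m                 ≡⟨ cong (4 *_) (ℕ.m∸n+n≡m p≤m) ⟨
  4 * (m ∸ p + p)       ≡⟨ ℕ.*-distribˡ-+ 4 (m ∸ p) p ⟩
  4 * (m ∸ p) + 4 * p   ≤⟨ ℕ.+-monoˡ-≤ (4 * p) (periodicRun-bound n p 1≤p (length u) (m ∸ p) (factor-periodicRun n u x v eq period)) ⟩
  3 * p + 4 * p         ≡⟨ ℕ.*-distribʳ-+ p 3 4 ⟨
  7 * p                 ∎
  where
  m = length x
  open ℕ.≤-Reasoning

theorem5 : (n : ℕ) → 1 ≤ n → (x : Word) → Factor x (φ^ n [ l2 ]) → 0 < length x →
    ExponentAtMost7/4 x
theorem5 n _ x (u , v , eq) _ p (period , _) = factor-exponent n u x v eq period
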